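{- Let $p$ be a prime and $u\in\mathbb{F}_p[x]$ monic of degree $d$ with $x\nmid u$. Then \[ E_{\min}(M_u^{2d}) \ge 2(p-1)^d - p^d\quad\text{and}\quad E_{\max}(M_u^{2d})\le (p-1)^d. \] In particular, $\|\widetilde M_u^{2d} - \tilde J_{p^d}\|_{\max}\le\left(\frac{p}{p-1}\right)^d - 1$.
   Context: Let $G_u$ be the directed graph with vertex set $\mathbb{F}_p[x]/(u)$ (of size $p^d$) and an edge from $\alpha$ to $\beta$ whenever $\beta = \alpha x + c$ for some $c\in\mathbb{F}_p\setminus\{0\}$ (loops allowed). $M_u$ is its adjacency matrix: the $(\beta,\alpha)$-entry is $1$ if $\beta=\alpha x + c$ for some nonzero $c\in\mathbb{F}_p$ and $0$ otherwise; $\widetilde M_u = (p-1)^{ -1}M_u$. For a real square matrix $M$ of size $m$: $E_{\min}(M)$, $E_{\max}(M)$ are its minimum and maximum entries, and $\|M\|_{\max} = m\cdot\max_{i,j}|M_{ij}|$. $\tilde J_N = (1/N)J_N$ with $J_N$ the $N\times N$ all-ones matrix. -}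

module Defs where

open import Data.Nat as ℕ using (ℕ; zero; suc; _∸_; _^_)
open import Data.Nat.DivMod using (_%_; m%n<n)
open import Data.Fin as Fin using (Fin; toℕ; fromℕ<)
open import Data.Vec as Vec using (Vec; []; _∷_)
open import Data.Vec.Properties using (≡-dec)
open import Data.List as List using (List; concatMap; allFin)
open import Data.Nat.ListAction using (sum)
open import Data.Product using (_×_; ∃)
open import Data.Unit using (⊤)
open import Data.Integer as ℤ using (ℤ; +_)
open import Data.Rational as ℚ using (ℚ; 0ℚ)
open import Relation.Nullary using (¬_; Dec; yes; no)
open import Relation.Nullary.Decidable using (_×-dec_; ¬?)
open import Relation.Binary.PropositionalEquality using (_≡_)
open import Data.Fin.Properties using (any?)

-- Arithmetic in F_p, with F_p represented as Fin p (p ≥ 1 is forced by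
-- having an element; p prime is assumed in the statement).

addF : ∀ {p} → Fin p → Fin p → Fin p
addF {suc n} a b = fromℕ< (m%n<n (toℕ a ℕ.+ toℕ b) (suc n))

mulF : ∀ {p} → Fin p → Fin p → Fin p
mulF {suc n} a b = fromℕ< (m%n<n (toℕ a ℕ.* toℕ b) (suc n))

negF : ∀ {p} → Fin p → Fin p
negF {suc n} a = fromℕ< (m%n<n (suc n ∸ toℕ a) (suc n))

subF : ∀ {p} → Fin p → Fin p → Fin p
subF a b = addF a (negF b)

-- A monic polynomial u of degree d over F_p,
--   u = x^d + u_{d-1} x^{d-1} + ... + u_1 x + u_0,
-- is represented by its non-leading coefficients (u_0, ..., u_{d-1}).
-- An element of F_p[x]/(u) is represented by its unique representative
-- of degree < d, i.e. its coefficient vector (a_0, ..., a_{d-1}).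

Monic : ℕ → ℕ → Set
Monic p d = Vec (Fin p) d

Residue : ℕ → ℕ → Set
Residue p d = Vec (Fin p) d

-- x ∤ u  iff  the constant coefficient of u is nonzero.
-- (If d = 0 then u = 1 and x ∤ u holds.)
XNotDividesMonic : ∀ {p d} → Monic p d → Set
XNotDividesMonic []      = ⊤
XNotDividesMonic (u₀ ∷ _) = ¬ (toℕ u₀ ≡ 0)

-- multiplication by x in F_p[x]/(u): using x^d ≡ -(u_0 + ... + u_{d-1}x^{d-1})
mulX : ∀ {p d} → Monic p d → Residue p d → Residue p d
mulX {d = zero}  u α = []
mulX {zero}  {suc k} u (() ∷ _)
mulX {suc n} {suc k} u α =
  Vec.zipWith (λ s uᵢ → subF s (mulF (Vec.last α) uᵢ)) (Fin.zero ∷ Vec.init α) u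

addConst : ∀ {p d} → Residue p d → Fin p → Residue p d
addConst []      c = []
addConst (a ∷ α) c = addF a c ∷ α

Edge : ∀ {p d} → Monic p d → Residue p d → Residue p d → Set
Edge {p} u α β = ∃ λ (c : Fin p) → ¬ (toℕ c ≡ 0) × (β ≡ addConst (mulX u α) c)

edge? : ∀ {p d} (u : Monic p d) α β → Dec (Edge u α β)
edge? {p} u α β = any? λ c → ¬? (toℕ c ℕ.≟ 0) ×-dec ≡-dec Fin._≟_ β (addConst (mulX u α) c)

allResidues : ∀ p d → List (Residue p d)
allResidues p zero    = List.[ [] ]
allResidues p (suc d) = concatMap (λ a → List.map (a ∷_) (allResidues p d)) (allFin p)

Matrix : ℕ → ℕ → Set
Matrix p d = Residue p d → Residue p d → ℕ

-- adjacency matrix: (β,α)-entry is 1 iff there is an edge α → β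
adjM : ∀ {p d} → Monic p d → Matrix p d
adjM u β α with edge? u α β
... | yes _ = 1
... | no  _ = 0

idM : ∀ {p d} → Matrix p d
idM β α with ≡-dec Fin._≟_ β α
... | yes _ = 1
... | no  _ = 0

mulM : ∀ {p d} → Matrix p d → Matrix p d → Matrix p d
mulM {p} {d} A B β α = sum (List.map (λ γ → A β γ ℕ.* B γ α) (allResidues p d))

powM : ∀ {p d} → Matrix p d → ℕ → Matrix p d
powM A zero    = idM
powM A (suc k) = mulM A (powM A k)

-- total rational division (denominator 0 gives 0; never used with 0)
_/′_ : ℤ → ℕ → ℚ
n /′ zero  = 0ℚ
n /′ suc m = n ℚ./ suc m

-- For d ≥ 1, a walk of length j ≤ d in G_u that starts at γ and adds the constants c₁, …, c_j
-- ends at γxʲ + c₁xʲ⁻¹ + ⋯ + c_j, and different constant sequences reach different endpoints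
-- because all degrees involved stay below d; so W = M_uᵈ is a 0/1 matrix. Every vertex has
-- out-degree p − 1 and, x being invertible modulo u when x ∤ u, also in-degree p − 1, so all row
-- and column sums of W equal (p − 1)ᵈ. An entry Σ_γ W_βγ W_γα of M_u²ᵈ = W·W is then at most a
-- column sum of W, and, as w + w′ ≤ w·w′ + 1 for w, w′ ∈ {0, 1}, at least 2(p − 1)ᵈ − pᵈ.
-- The rational bound is a rearrangement of these two integer bounds.

module Submission where

open import Defs
open import Data.Nat as ℕ using (ℕ; _∸_; _^_)
open import Data.Nat.Primality using (Prime)
open import Data.Integer as ℤ using (+_)
open import Data.Rational as ℚ using (ℚ)
open import Data.Product using (_×_)

open import Algebra.Properties.CommutativeSemigroup as CommSemigroupProps using ()
open import Data.Fin as Fin using (Fin; toℕ)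
open import Data.Fin.Properties using (toℕ-injective; toℕ-fromℕ<; toℕ<n; any?)
open import Data.Integer using (ℤ; 0ℤ; +≤+; _⊖_)
import Data.Integer.Properties as ℤ
open import Data.Integer.Tactic.RingSolver using (solve-∀)
open import Data.List as List using (List; []; _∷_; map; length; allFin; concatMap)
open import Data.List.Membership.Propositional using (_∈_)
open import Data.List.Membership.Propositional.Properties using (∈-allFin; ∈-map⁺; ∈-map⁻; ∈-concat⁺′)
open import Data.List.Properties using (length-++; length-map; length-tabulate; map-tabulate)
open import Data.List.Relation.Unary.All as All using (All; []; _∷_)
import Data.List.Relation.Unary.All.Properties as All
open import Data.List.Relation.Unary.AllPairs as AllPairs using ([]; _∷_)
import Data.List.Relation.Unary.AllPairs.Properties as AllPairs
open import Data.List.Relation.Unary.Any using (here; there)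
open import Data.List.Relation.Unary.Unique.Propositional using (Unique)
import Data.List.Relation.Unary.Unique.Propositional.Properties as Unique
open import Data.Nat using (zero; suc; _+_; _*_; _≤_; _<_; NonZero; z≤n; s≤s)
open import Data.Nat.DivMod using (_%_; %-distribˡ-+; [m+n]%n≡m%n; [m+kn]%n≡m%n; m<n⇒m%n≡m; m*n%n≡0)
open import Data.Nat.Divisibility using (_∣_; _∤_; m%n≡0⇒n∣m; >⇒∤)
open import Data.Nat.ListAction using (sum)
open import Data.Nat.Primality using (euclidsLemma; ¬prime[0]; ¬prime[1])
open import Data.Nat.Properties
open import Data.Product using (_,_; proj₁; proj₂)
open import Data.Rational using (toℚᵘ)
open import Data.Rational.Properties using (toℚᵘ-cancel-≤; toℚᵘ-homo-*; toℚᵘ-homo-+; toℚᵘ-homo‿-; toℚᵘ-fromℚᵘ; ∣p∣≡p∨∣p∣≡-p)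
open import Data.Rational.Unnormalised as ℚᵘ using (ℚᵘ; mkℚᵘ; *≤*)
import Data.Rational.Unnormalised.Properties as ℚᵘ
open import Data.Sum using (inj₁; inj₂; [_,_]′)
open import Data.Vec as Vec using (Vec; _∷_)
open import Data.Vec.Properties using (≡-dec; ∷-injectiveˡ; ∷-injectiveʳ)
open import Function using (id)
open import Level using (0ℓ)
open import Relation.Binary.PropositionalEquality
open import Relation.Nullary using (¬_; Dec; yes; no; contradiction)
open import Relation.Nullary.Decidable using (_×-dec_; ¬?)
open import Relation.Unary using (Pred; Decidable)

open CommSemigroupProps +-commutativeSemigroup using ()
  renaming (interchange to +-interchange; x∙yz≈y∙xz to x+[y+z]≡y+[x+z])
open CommSemigroupProps *-commutativeSemigroup using ()
  renaming (interchange to *-interchange; x∙yz≈y∙xz to x*[y*z]≡y*[x*z])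

-- Arithmetic modulo m

%-cong-+ʳ : ∀ {m} .{{_ : NonZero m}} x y k → x % m ≡ y % m → (x + k) % m ≡ (y + k) % m
%-cong-+ʳ {m} x y k eq = begin
  (x + k) % m          ≡⟨ %-distribˡ-+ x k m ⟩
  (x % m + k % m) % m  ≡⟨ cong (λ r → (r + k % m) % m) eq ⟩
  (y % m + k % m) % m  ≡⟨ %-distribˡ-+ y k m ⟨
  (y + k) % m          ∎
  where open ≡-Reasoning

%-cancel-+ʳ : ∀ {m} .{{_ : NonZero m}} x y k → (x + k) % m ≡ (y + k) % m → x % m ≡ y % m
%-cancel-+ʳ {m@(suc m-1)} x y k eq = begin
  x % m                    ≡⟨ [m+kn]%n≡m%n x k m ⟨
  (x + k * m) % m          ≡⟨ cong (_% m) (split x) ⟩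
  (x + k + k * m-1) % m    ≡⟨ %-cong-+ʳ (x + k) (y + k) (k * m-1) eq ⟩
  (y + k + k * m-1) % m    ≡⟨ cong (_% m) (split y) ⟨
  (y + k * m) % m          ≡⟨ [m+kn]%n≡m%n y k m ⟩
  y % m                    ∎
  where
  open ≡-Reasoning
  split : ∀ z → z + k * m ≡ z + k + k * m-1
  split z = trans (cong (λ w → z + w) (*-suc k m-1)) (sym (+-assoc z k (k * m-1)))

<⇒%-injective : ∀ {m} .{{_ : NonZero m}} {x y} → x < m → y < m → x % m ≡ y % m → x ≡ y
<⇒%-injective x<m y<m eq = trans (sym (m<n⇒m%n≡m x<m)) (trans eq (m<n⇒m%n≡m y<m))

∸-%-injective : ∀ {m} .{{_ : NonZero m}} {x y} → x ≤ m → y ≤ m →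
  (m ∸ x) % m ≡ (m ∸ y) % m → x % m ≡ y % m
∸-%-injective {m} {x} {y} x≤m y≤m eq = %-cancel-+ʳ x y ((m ∸ x) + (m ∸ y)) (begin
  (x + ((m ∸ x) + (m ∸ y))) % m  ≡⟨ cong (_% m) (complement x≤m (m ∸ y)) ⟩
  ((m ∸ y) + m) % m              ≡⟨ [m+n]%n≡m%n (m ∸ y) m ⟩
  (m ∸ y) % m                    ≡⟨ eq ⟨
  (m ∸ x) % m                    ≡⟨ [m+n]%n≡m%n (m ∸ x) m ⟨
  ((m ∸ x) + m) % m              ≡⟨ cong (_% m) (complement y≤m (m ∸ x)) ⟨
  (y + ((m ∸ y) + (m ∸ x))) % m  ≡⟨ cong (λ k → (y + k) % m) (+-comm (m ∸ y) (m ∸ x)) ⟩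
  (y + ((m ∸ x) + (m ∸ y))) % m  ∎)
  where
  open ≡-Reasoning
  complement : ∀ {z} → z ≤ m → ∀ w → z + ((m ∸ z) + w) ≡ w + m
  complement {z} z≤m w = begin
    z + ((m ∸ z) + w)  ≡⟨ +-assoc z (m ∸ z) w ⟨
    z + (m ∸ z) + w    ≡⟨ cong (_+ w) (m+[n∸m]≡n z≤m) ⟩
    m + w              ≡⟨ +-comm m w ⟩
    w + m              ∎

%≡%⇒∣∸ : ∀ {m} .{{_ : NonZero m}} {x y} → x ≤ y → x % m ≡ y % m → m ∣ y ∸ x
%≡%⇒∣∸ {m} {x} {y} x≤y eq = m%n≡0⇒n∣m (y ∸ x) m (trans
  (%-cancel-+ʳ (y ∸ x) 0 x (trans (cong (_% m) (m∸n+n≡m x≤y)) (sym eq)))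
  (m*n%n≡0 0 m))

∣∧<⇒≡0 : ∀ {m k} → m ∣ k → k < m → k ≡ 0
∣∧<⇒≡0 {k = zero}  _   _   = refl
∣∧<⇒≡0 {k = suc _} m∣k k<m = contradiction m∣k (>⇒∤ k<m)

prime⇒%-cancel-*ʳ : ∀ {m} .{{_ : NonZero m}} {c} → Prime m → m ∤ c →
  ∀ {x y} → x < m → y < m → (x * c) % m ≡ (y * c) % m → x ≡ y
prime⇒%-cancel-*ʳ {m} {c} m-prime m∤c {x} {y} x<m y<m eq =
  [ (λ x≤y → ordered x≤y y<m eq) , (λ y≤x → sym (ordered y≤x x<m (sym eq))) ]′ (≤-total x y)
  where
  ordered : ∀ {x y} → x ≤ y → y < m → (x * c) % m ≡ (y * c) % m → x ≡ y
  ordered {x} {y} x≤y y<m eq with euclidsLemma (y ∸ x) c m-prime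
    (subst (m ∣_) (sym (*-distribʳ-∸ c y x)) (%≡%⇒∣∸ (*-monoˡ-≤ c x≤y) eq))
  ... | inj₁ m∣y∸x = ≤-antisym x≤y (m∸n≡0⇒m≤n (∣∧<⇒≡0 m∣y∸x (≤-<-trans (m∸n≤m y x) y<m)))
  ... | inj₂ m∣c   = contradiction m∣c m∤c

-- The field 𝔽ₚ, represented as Fin p

module _ {n : ℕ} where

  toℕ-addF : (a b : Fin (suc n)) → toℕ (addF a b) ≡ (toℕ a + toℕ b) % suc n
  toℕ-addF a b = toℕ-fromℕ< _

  toℕ-mulF : (a b : Fin (suc n)) → toℕ (mulF a b) ≡ (toℕ a * toℕ b) % suc n
  toℕ-mulF a b = toℕ-fromℕ< _

  toℕ-negF : (a : Fin (suc n)) → toℕ (negF a) ≡ (suc n ∸ toℕ a) % suc n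
  toℕ-negF a = toℕ-fromℕ< _

  addF-comm : (a b : Fin (suc n)) → addF a b ≡ addF b a
  addF-comm a b = toℕ-injective (begin
    toℕ (addF a b)               ≡⟨ toℕ-addF a b ⟩
    (toℕ a + toℕ b) % suc n      ≡⟨ cong (_% suc n) (+-comm (toℕ a) (toℕ b)) ⟩
    (toℕ b + toℕ a) % suc n      ≡⟨ toℕ-addF b a ⟨
    toℕ (addF b a)               ∎)
    where open ≡-Reasoning

  addF-cancelʳ : ∀ (c : Fin (suc n)) {a a'} → addF a c ≡ addF a' c → a ≡ a'
  addF-cancelʳ c {a} {a'} eq = toℕ-injective (<⇒%-injective (toℕ<n a) (toℕ<n a')
    (%-cancel-+ʳ (toℕ a) (toℕ a') (toℕ c)
      (trans (sym (toℕ-addF a c)) (trans (cong toℕ eq) (toℕ-addF a' c)))))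

  addF-cancelˡ : ∀ (c : Fin (suc n)) {a a'} → addF c a ≡ addF c a' → a ≡ a'
  addF-cancelˡ c {a} {a'} eq = addF-cancelʳ c (trans (addF-comm a c) (trans eq (addF-comm c a')))

  negF-injective : ∀ {a a' : Fin (suc n)} → negF a ≡ negF a' → a ≡ a'
  negF-injective {a} {a'} eq = toℕ-injective (<⇒%-injective (toℕ<n a) (toℕ<n a')
    (∸-%-injective (<⇒≤ (toℕ<n a)) (<⇒≤ (toℕ<n a'))
      (trans (sym (toℕ-negF a)) (trans (cong toℕ eq) (toℕ-negF a')))))

  subF-cancelʳ : ∀ (b : Fin (suc n)) {a a'} → subF a b ≡ subF a' b → a ≡ a'
  subF-cancelʳ b = addF-cancelʳ (negF b)

  subF-cancelˡ : ∀ (a : Fin (suc n)) {b b'} → subF a b ≡ subF a b' → b ≡ b'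
  subF-cancelˡ a eq = negF-injective (addF-cancelˡ a eq)

  mulF-cancelʳ : Prime (suc n) → ∀ (c : Fin (suc n)) {a a'} → toℕ c ≢ 0 →
    mulF a c ≡ mulF a' c → a ≡ a'
  mulF-cancelʳ p-prime c {a} {a'} c≢0 eq = toℕ-injective
    (prime⇒%-cancel-*ʳ p-prime (λ p∣c → c≢0 (∣∧<⇒≡0 p∣c (toℕ<n c))) (toℕ<n a) (toℕ<n a')
      (trans (sym (toℕ-mulF a c)) (trans (cong toℕ eq) (toℕ-mulF a' c))))

-- Sums over finite lists

+-saturated : ∀ {m n o} → m ≤ 1 → n ≤ o → m + n ≡ suc o → m ≡ 1 × n ≡ o
+-saturated {m} {n} {o} m≤1 n≤o eq =
  ≤-antisym m≤1 (+-cancelʳ-≤ o 1 m (≤-trans (≤-reflexive (sym eq)) (+-monoʳ-≤ m n≤o))) ,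
  ≤-antisym n≤o (+-cancelˡ-≤ 1 o n (≤-trans (≤-reflexive (sym eq)) (+-monoˡ-≤ n m≤1)))

∑ : {A : Set} → List A → (A → ℕ) → ℕ
∑ xs f = sum (map f xs)

module _ {A : Set} where

  ∑-cong : ∀ xs {f g : A → ℕ} → (∀ x → f x ≡ g x) → ∑ xs f ≡ ∑ xs g
  ∑-cong []       f≗g = refl
  ∑-cong (x ∷ xs) f≗g = cong₂ _+_ (f≗g x) (∑-cong xs f≗g)

  ∑-mono-≤ : ∀ xs {f g : A → ℕ} → (∀ x → f x ≤ g x) → ∑ xs f ≤ ∑ xs g
  ∑-mono-≤ []       f≤g = z≤n
  ∑-mono-≤ (x ∷ xs) f≤g = +-mono-≤ (f≤g x) (∑-mono-≤ xs f≤g)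

  ∑-zero : ∀ {xs} {f : A → ℕ} → All (λ x → f x ≡ 0) xs → ∑ xs f ≡ 0
  ∑-zero []           = refl
  ∑-zero (fx≡0 ∷ all) = cong₂ _+_ fx≡0 (∑-zero all)

  ∑-+ : ∀ xs (f g : A → ℕ) → ∑ xs (λ x → f x + g x) ≡ ∑ xs f + ∑ xs g
  ∑-+ []       f g = refl
  ∑-+ (x ∷ xs) f g = trans (cong (_+_ (f x + g x)) (∑-+ xs f g)) (+-interchange (f x) (g x) (∑ xs f) (∑ xs g))

  ∑-*ˡ : ∀ xs k (f : A → ℕ) → ∑ xs (λ x → k * f x) ≡ k * ∑ xs f
  ∑-*ˡ []       k f = sym (*-zeroʳ k)
  ∑-*ˡ (x ∷ xs) k f = trans (cong (_+_ (k * f x)) (∑-*ˡ xs k f)) (sym (*-distribˡ-+ k (f x) (∑ xs f)))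

  ∑-*ʳ : ∀ xs k (f : A → ℕ) → ∑ xs (λ x → f x * k) ≡ ∑ xs f * k
  ∑-*ʳ xs k f = trans (∑-cong xs (λ x → *-comm (f x) k)) (trans (∑-*ˡ xs k f) (*-comm k (∑ xs f)))

  ∑-const : ∀ xs k → ∑ xs (λ (_ : A) → k) ≡ length xs * k
  ∑-const []       k = refl
  ∑-const (x ∷ xs) k = cong (_+_ k) (∑-const xs k)

  ∑-1≡length : ∀ xs → ∑ xs (λ (_ : A) → 1) ≡ length xs
  ∑-1≡length xs = trans (∑-const xs 1) (*-identityʳ (length xs))

  ∑-≤-length : ∀ xs {f : A → ℕ} → (∀ x → f x ≤ 1) → ∑ xs f ≤ length xs
  ∑-≤-length []       f≤1 = z≤n
  ∑-≤-length (x ∷ xs) f≤1 = +-mono-≤ (f≤1 x) (∑-≤-length xs f≤1)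

  ∑-saturated : ∀ {xs} {f : A → ℕ} → (∀ x → f x ≤ 1) → ∑ xs f ≡ length xs →
    ∀ {x} → x ∈ xs → f x ≡ 1
  ∑-saturated {y ∷ ys} f≤1 eq (here refl) = proj₁ (+-saturated (f≤1 y) (∑-≤-length ys f≤1) eq)
  ∑-saturated {y ∷ ys} f≤1 eq (there x∈ys) =
    ∑-saturated f≤1 (proj₂ (+-saturated (f≤1 y) (∑-≤-length ys f≤1) eq)) x∈ys

  ∑-delta : ∀ {xs b} {f : A → ℕ} → Unique xs → b ∈ xs → (∀ x → x ≢ b → f x ≡ 0) → ∑ xs f ≡ f b
  ∑-delta {x ∷ xs} {f = f} (x∉xs ∷ _) (here refl) f-off =
    trans (cong (_+_ (f x)) (∑-zero (All.map (λ x≢y → f-off _ (≢-sym x≢y)) x∉xs))) (+-identityʳ (f x))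
  ∑-delta {x ∷ xs} (x∉xs ∷ xs!) (there b∈xs) f-off =
    cong₂ _+_ (f-off x (All.lookup x∉xs b∈xs)) (∑-delta xs! b∈xs f-off)

  ∑-≤1 : ∀ {xs} {f : A → ℕ} → Unique xs → (∀ x → f x ≤ 1) →
    (∀ x y → x ≢ y → f x * f y ≡ 0) → ∑ xs f ≤ 1
  ∑-≤1 {[]}     _            _   _    = z≤n
  ∑-≤1 {x ∷ xs} {f} (x∉xs ∷ xs!) f≤1 disj =
    [ (λ fx≡0 → subst (λ t → t + ∑ xs f ≤ 1) (sym fx≡0) (∑-≤1 xs! f≤1 disj))
    , (λ rest≡0 → subst (λ t → f x + t ≤ 1) (sym rest≡0) (subst (_≤ 1) (sym (+-identityʳ (f x))) (f≤1 x)))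
    ]′ (m*n≡0⇒m≡0∨n≡0 (f x) cross)
    where
    cross : f x * ∑ xs f ≡ 0
    cross = trans (sym (∑-*ˡ xs (f x) f)) (∑-zero (All.map (disj x _) x∉xs))

module _ {A B : Set} where

  ∑-swap : ∀ (xs : List A) (ys : List B) (h : A → B → ℕ) →
    ∑ xs (λ x → ∑ ys (h x)) ≡ ∑ ys (λ y → ∑ xs (λ x → h x y))
  ∑-swap []       ys h = sym (∑-zero (All.universal (λ _ → refl) ys))
  ∑-swap (x ∷ xs) ys h = trans (cong (_+_ (∑ ys (h x))) (∑-swap xs ys h))
    (sym (∑-+ ys (h x) (λ y → ∑ xs (λ x → h x y))))

  ∑-* : ∀ (xs : List A) (ys : List B) (f : A → ℕ) (g : B → ℕ) →
    ∑ xs f * ∑ ys g ≡ ∑ xs (λ x → ∑ ys (λ y → f x * g y))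
  ∑-* xs ys f g = trans (sym (∑-*ʳ xs (∑ ys g) f)) (∑-cong xs (λ x → sym (∑-*ˡ ys (f x) g)))

𝟙 : ∀ {ℓ} {P : Set ℓ} → Dec P → ℕ
𝟙 (yes _) = 1
𝟙 (no _)  = 0

𝟙≤1 : ∀ {ℓ} {P : Set ℓ} (P? : Dec P) → 𝟙 P? ≤ 1
𝟙≤1 (yes _) = s≤s z≤n
𝟙≤1 (no _)  = z≤n

𝟙-yes : ∀ {ℓ} {P : Set ℓ} (P? : Dec P) → P → 𝟙 P? ≡ 1
𝟙-yes (yes _) _ = refl
𝟙-yes (no ¬p) p = contradiction p ¬p

𝟙-no : ∀ {ℓ} {P : Set ℓ} (P? : Dec P) → ¬ P → 𝟙 P? ≡ 0
𝟙-no (yes p) ¬p = contradiction p ¬p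
𝟙-no (no _)  _  = refl

𝟙-×-dec : ∀ {ℓ} {P Q : Set ℓ} (P? : Dec P) (Q? : Dec Q) → 𝟙 (P? ×-dec Q?) ≡ 𝟙 P? * 𝟙 Q?
𝟙-×-dec (yes _) (yes _) = refl
𝟙-×-dec (yes _) (no _)  = refl
𝟙-×-dec (no _)  _       = refl

𝟙-*-disjoint : ∀ {ℓ} {P Q : Set ℓ} (P? : Dec P) (Q? : Dec Q) → (P → ¬ Q) → 𝟙 P? * 𝟙 Q? ≡ 0
𝟙-*-disjoint P? Q? disjoint = trans (sym (𝟙-×-dec P? Q?)) (𝟙-no (P? ×-dec Q?) (λ (p , q) → disjoint p q))

𝟙-any? : ∀ {m} {P : Pred (Fin m) 0ℓ} (P? : Decidable P) → (∀ {c c'} → P c → P c' → c ≡ c') →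
  𝟙 (any? P?) ≡ ∑ (allFin m) (λ c → 𝟙 (P? c))
𝟙-any? {m} P? unique with any? P?
... | yes (c , pc) = sym (trans
  (∑-delta (Unique.allFin⁺ m) (∈-allFin c) (λ c' c'≢c → 𝟙-no (P? c') (λ pc' → c'≢c (unique pc' pc))))
  (𝟙-yes (P? c) pc))
... | no ¬∃ = sym (∑-zero (All.universal (λ c → 𝟙-no (P? c) (λ pc → ¬∃ (c , pc))) (allFin m)))

-- Residues modulo u and matrices indexed by them

length-concatMap : ∀ {A B : Set} (f : A → List B) {k} → (∀ x → length (f x) ≡ k) →
  ∀ xs → length (concatMap f xs) ≡ length xs * k
length-concatMap f len []       = refl
length-concatMap f len (x ∷ xs) =
  trans (length-++ (f x)) (cong₂ _+_ (len x) (length-concatMap f len xs))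

length-allResidues : ∀ p d → length (allResidues p d) ≡ p ^ d
length-allResidues p zero    = refl
length-allResidues p (suc d) = trans
  (length-concatMap _ (λ a → trans (length-map (a ∷_) (allResidues p d)) (length-allResidues p d)) (allFin p))
  (cong (_* p ^ d) (length-tabulate {n = p} id))

∈-allResidues : ∀ {p d} (α : Residue p d) → α ∈ allResidues p d
∈-allResidues Vec.[]  = here refl
∈-allResidues (a ∷ α) = ∈-concat⁺′ (∈-map⁺ (a ∷_) (∈-allResidues α)) (∈-map⁺ _ (∈-allFin a))

allResidues-unique : ∀ p d → Unique (allResidues p d)
allResidues-unique p zero    = [] ∷ []
allResidues-unique p (suc d) = Unique.concat⁺
  (All.map⁺ (All.universal (λ a → Unique.map⁺ ∷-injectiveʳ (allResidues-unique p d)) (allFin p)))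
  (AllPairs.map⁺ (AllPairs.map disjoint (Unique.allFin⁺ p)))
  where
  disjoint : ∀ {a a'} → a ≢ a' → ∀ {α} → ¬ (α ∈ map (a ∷_) (allResidues p d) × α ∈ map (a' ∷_) (allResidues p d))
  disjoint a≢a' (α∈ , α∈') with ∈-map⁻ (_ ∷_) α∈ | ∈-map⁻ (_ ∷_) α∈'
  ... | _ , _ , refl | _ , _ , eq = a≢a' (∷-injectiveˡ eq)

∑ᵣ : ∀ {p d} → (Residue p d → ℕ) → ℕ
∑ᵣ {p} {d} = ∑ (allResidues p d)

_≟ᵣ_ : ∀ {p d} (α β : Residue p d) → Dec (α ≡ β)
_≟ᵣ_ = ≡-dec Fin._≟_

∑ᵣ-delta : ∀ {p d} {f : Residue p d → ℕ} β → (∀ γ → γ ≢ β → f γ ≡ 0) → ∑ᵣ f ≡ f β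
∑ᵣ-delta {p} {d} β = ∑-delta (allResidues-unique p d) (∈-allResidues β)

∑ᵣ-indicator : ∀ {p d} (β : Residue p d) → ∑ᵣ (λ γ → 𝟙 (γ ≟ᵣ β)) ≡ 1
∑ᵣ-indicator β = trans (∑ᵣ-delta β (λ γ γ≢β → 𝟙-no (γ ≟ᵣ β) γ≢β)) (𝟙-yes (β ≟ᵣ β) refl)

∑ᵣ-fibre-injective : ∀ {p d} (f : Residue p d → Residue p d) → (∀ {x y} → f x ≡ f y → x ≡ y) →
  ∀ β → ∑ᵣ (λ γ → 𝟙 (β ≟ᵣ f γ)) ≡ 1
∑ᵣ-fibre-injective {p} {d} f f-injective β =
  ∑-saturated fibre≤1 total (∈-allResidues β)
  where
  fibre : Residue p d → ℕ
  fibre δ = ∑ᵣ (λ γ → 𝟙 (δ ≟ᵣ f γ))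
  fibre≤1 : ∀ δ → fibre δ ≤ 1
  fibre≤1 δ = ∑-≤1 (allResidues-unique p d) (λ γ → 𝟙≤1 (δ ≟ᵣ f γ))
    (λ γ γ' γ≢γ' → 𝟙-*-disjoint (δ ≟ᵣ f γ) (δ ≟ᵣ f γ')
      (λ δ≡fγ δ≡fγ' → γ≢γ' (f-injective (trans (sym δ≡fγ) δ≡fγ'))))
  total : ∑ᵣ fibre ≡ length (allResidues p d)
  total = begin
    ∑ᵣ fibre                                     ≡⟨ ∑-swap (allResidues p d) (allResidues p d) _ ⟩
    ∑ᵣ (λ γ → ∑ᵣ (λ β → 𝟙 (β ≟ᵣ f γ)))          ≡⟨ ∑-cong (allResidues p d) (λ γ → ∑ᵣ-indicator (f γ)) ⟩
    ∑ᵣ {p} {d} (λ _ → 1)                         ≡⟨ ∑-1≡length (allResidues p d) ⟩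
    length (allResidues p d)                     ∎
    where open ≡-Reasoning

m≤1⇒m*n≤n : ∀ {m} n → m ≤ 1 → m * n ≤ n
m≤1⇒m*n≤n {zero}        n _           = z≤n
m≤1⇒m*n≤n {suc zero}    n _           = ≤-reflexive (+-identityʳ n)
m≤1⇒m*n≤n {suc (suc m)} n (s≤s ())

m+n≤m*n+1 : ∀ {m n} → m ≤ 1 → n ≤ 1 → m + n ≤ m * n + 1
m+n≤m*n+1 {zero}        _        n≤1 = n≤1
m+n≤m*n+1 {suc zero}    {n} _    _   = ≤-reflexive (trans (+-comm 1 n) (cong (_+ 1) (sym (+-identityʳ n))))
m+n≤m*n+1 {suc (suc m)} (s≤s ()) _

_≈ₘ_ : ∀ {p d} → Matrix p d → Matrix p d → Set
A ≈ₘ B = ∀ β α → A β α ≡ B β α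

rowSum : ∀ {p d} → Matrix p d → Residue p d → ℕ
rowSum A β = ∑ᵣ (A β)

colSum : ∀ {p d} → Matrix p d → Residue p d → ℕ
colSum A α = ∑ᵣ (λ β → A β α)

module _ {p d : ℕ} where

  private
    Rs : List (Residue p d)
    Rs = allResidues p d

  idM≡𝟙 : (β α : Residue p d) → idM β α ≡ 𝟙 (β ≟ᵣ α)
  idM≡𝟙 β α with β ≟ᵣ α
  ... | yes _ = refl
  ... | no _  = refl

  idM-diagonal : (β : Residue p d) → idM β β ≡ 1
  idM-diagonal β = trans (idM≡𝟙 β β) (𝟙-yes (β ≟ᵣ β) refl)

  idM-offDiagonal : ∀ {β α : Residue p d} → β ≢ α → idM β α ≡ 0
  idM-offDiagonal {β} {α} β≢α = trans (idM≡𝟙 β α) (𝟙-no (β ≟ᵣ α) β≢α)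

  idM≤1 : (β α : Residue p d) → idM β α ≤ 1
  idM≤1 β α = subst (_≤ 1) (sym (idM≡𝟙 β α)) (𝟙≤1 (β ≟ᵣ α))

  idM-rowSum : ∀ β → rowSum (idM {p} {d}) β ≡ 1
  idM-rowSum β = trans (∑ᵣ-delta β (λ γ γ≢β → idM-offDiagonal (≢-sym γ≢β))) (idM-diagonal β)

  idM-colSum : ∀ α → colSum (idM {p} {d}) α ≡ 1
  idM-colSum α = trans (∑ᵣ-delta α (λ β β≢α → idM-offDiagonal β≢α)) (idM-diagonal α)

  mulM-identityˡ : (B : Matrix p d) → mulM idM B ≈ₘ B
  mulM-identityˡ B β α = begin
    ∑ᵣ (λ γ → idM β γ * B γ α)  ≡⟨ ∑ᵣ-delta β (λ γ γ≢β → cong (_* B γ α) (idM-offDiagonal (≢-sym γ≢β))) ⟩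
    idM β β * B β α             ≡⟨ cong (_* B β α) (idM-diagonal β) ⟩
    1 * B β α                   ≡⟨ *-identityˡ (B β α) ⟩
    B β α                       ∎
    where open ≡-Reasoning

  mulM-identityʳ : (A : Matrix p d) → mulM A idM ≈ₘ A
  mulM-identityʳ A β α = begin
    ∑ᵣ (λ γ → A β γ * idM γ α)  ≡⟨ ∑ᵣ-delta α (λ γ γ≢α → trans (cong (A β γ *_) (idM-offDiagonal γ≢α)) (*-zeroʳ (A β γ))) ⟩
    A β α * idM α α             ≡⟨ cong (A β α *_) (idM-diagonal α) ⟩
    A β α * 1                   ≡⟨ *-identityʳ (A β α) ⟩
    A β α                       ∎
    where open ≡-Reasoning

  mulM-congʳ : (A : Matrix p d) {B B' : Matrix p d} → B ≈ₘ B' → mulM A B ≈ₘ mulM A B'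
  mulM-congʳ A B≈B' β α = ∑-cong Rs (λ γ → cong (A β γ *_) (B≈B' γ α))

  mulM-assoc : (A B C : Matrix p d) → mulM A (mulM B C) ≈ₘ mulM (mulM A B) C
  mulM-assoc A B C β α = begin
    ∑ᵣ (λ γ → A β γ * ∑ᵣ (λ δ → B γ δ * C δ α))    ≡⟨ ∑-cong Rs (λ γ → sym (∑-*ˡ Rs (A β γ) _)) ⟩
    ∑ᵣ (λ γ → ∑ᵣ (λ δ → A β γ * (B γ δ * C δ α)))  ≡⟨ ∑-swap Rs Rs _ ⟩
    ∑ᵣ (λ δ → ∑ᵣ (λ γ → A β γ * (B γ δ * C δ α)))  ≡⟨ ∑-cong Rs (λ δ → ∑-cong Rs (λ γ → sym (*-assoc (A β γ) (B γ δ) (C δ α)))) ⟩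
    ∑ᵣ (λ δ → ∑ᵣ (λ γ → A β γ * B γ δ * C δ α))    ≡⟨ ∑-cong Rs (λ δ → ∑-*ʳ Rs (C δ α) _) ⟩
    ∑ᵣ (λ δ → ∑ᵣ (λ γ → A β γ * B γ δ) * C δ α)    ∎
    where open ≡-Reasoning

  powM-+ : (A : Matrix p d) (i j : ℕ) → powM A (i + j) ≈ₘ mulM (powM A i) (powM A j)
  powM-+ A zero    j β α = sym (mulM-identityˡ (powM A j) β α)
  powM-+ A (suc i) j β α =
    trans (mulM-congʳ A (powM-+ A i j) β α) (mulM-assoc A (powM A i) (powM A j) β α)

  powM-sucʳ : (A : Matrix p d) (j : ℕ) → powM A (suc j) ≈ₘ mulM (powM A j) A
  powM-sucʳ A j β α = begin
    powM A (suc j) β α              ≡⟨ cong (λ i → powM A i β α) (+-comm 1 j) ⟩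
    powM A (j + 1) β α              ≡⟨ powM-+ A j 1 β α ⟩
    mulM (powM A j) (mulM A idM) β α ≡⟨ mulM-congʳ (powM A j) (mulM-identityʳ A) β α ⟩
    mulM (powM A j) A β α           ∎
    where open ≡-Reasoning

  powM-rowSum : ∀ {A : Matrix p d} {r} → (∀ β → rowSum A β ≡ r) → ∀ j β → rowSum (powM A j) β ≡ r ^ j
  powM-rowSum         rows zero    β = idM-rowSum β
  powM-rowSum {A} {r} rows (suc j) β = begin
    ∑ᵣ (λ γ → ∑ᵣ (λ δ → A β δ * powM A j δ γ))  ≡⟨ ∑-swap Rs Rs _ ⟩
    ∑ᵣ (λ δ → ∑ᵣ (λ γ → A β δ * powM A j δ γ))  ≡⟨ ∑-cong Rs (λ δ → trans (∑-*ˡ Rs (A β δ) _) (cong (A β δ *_) (powM-rowSum rows j δ))) ⟩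
    ∑ᵣ (λ δ → A β δ * r ^ j)                    ≡⟨ ∑-*ʳ Rs (r ^ j) (A β) ⟩
    rowSum A β * r ^ j                          ≡⟨ cong (_* r ^ j) (rows β) ⟩
    r * r ^ j                                   ∎
    where open ≡-Reasoning

  powM-colSum : ∀ {A : Matrix p d} {r} → (∀ α → colSum A α ≡ r) → ∀ j α → colSum (powM A j) α ≡ r ^ j
  powM-colSum         cols zero    α = idM-colSum α
  powM-colSum {A} {r} cols (suc j) α = begin
    ∑ᵣ (λ β → ∑ᵣ (λ δ → A β δ * powM A j δ α))  ≡⟨ ∑-swap Rs Rs _ ⟩
    ∑ᵣ (λ δ → ∑ᵣ (λ β → A β δ * powM A j δ α))  ≡⟨ ∑-cong Rs (λ δ → trans (∑-*ʳ Rs (powM A j δ α) _) (cong (_* powM A j δ α) (cols δ))) ⟩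
    ∑ᵣ (λ δ → r * powM A j δ α)                 ≡⟨ ∑-*ˡ Rs r (λ δ → powM A j δ α) ⟩
    r * colSum (powM A j) α                     ≡⟨ cong (r *_) (powM-colSum cols j α) ⟩
    r * r ^ j                                   ∎
    where open ≡-Reasoning

  square-bounds : ∀ {W : Matrix p d} {a} → (∀ β α → W β α ≤ 1) →
    (∀ β → rowSum W β ≡ a) → (∀ α → colSum W α ≡ a) →
    ∀ β α → (a + a ≤ mulM W W β α + p ^ d) × (mulM W W β α ≤ a)
  square-bounds {W} {a} W≤1 rows cols β α = lower , upper
    where
    open ≤-Reasoning
    lower : a + a ≤ mulM W W β α + p ^ d
    lower = begin
      a + a                                            ≡⟨ cong₂ _+_ (rows β) (cols α) ⟨
      rowSum W β + colSum W α                          ≡⟨ ∑-+ Rs (W β) (λ γ → W γ α) ⟨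
      ∑ᵣ (λ γ → W β γ + W γ α)                         ≤⟨ ∑-mono-≤ Rs (λ γ → m+n≤m*n+1 (W≤1 β γ) (W≤1 γ α)) ⟩
      ∑ᵣ (λ γ → W β γ * W γ α + 1)                     ≡⟨ ∑-+ Rs (λ γ → W β γ * W γ α) (λ _ → 1) ⟩
      mulM W W β α + ∑ᵣ {p} {d} (λ _ → 1)              ≡⟨ cong (_+_ (mulM W W β α)) (∑-1≡length Rs) ⟩
      mulM W W β α + length Rs                         ≡⟨ cong (_+_ (mulM W W β α)) (length-allResidues p d) ⟩
      mulM W W β α + p ^ d                             ∎
    upper : mulM W W β α ≤ a
    upper = begin
      mulM W W β α    ≤⟨ ∑-mono-≤ Rs (λ γ → m≤1⇒m*n≤n (W γ α) (W≤1 β γ)) ⟩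
      colSum W α      ≡⟨ cols α ⟩
      a               ∎

-- Walks in G_u

init-last-injective : ∀ {A : Set} {m} {xs ys : Vec A (suc m)} →
  Vec.init xs ≡ Vec.init ys → Vec.last xs ≡ Vec.last ys → xs ≡ ys
init-last-injective {xs = xs} {ys} init≡ last≡ =
  trans (split xs) (trans (cong₂ Vec._∷ʳ_ init≡ last≡) (sym (split ys)))
  where
  split : ∀ zs → zs ≡ Vec.init zs Vec.∷ʳ Vec.last zs
  split zs = proj₂ (proj₂ (Vec.initLast zs))

zipWith-injectiveˡ : ∀ {A B C : Set} {f : A → B → C} → (∀ {x x' z} → f x z ≡ f x' z → x ≡ x') →
  ∀ {m} {xs ys : Vec A m} (zs : Vec B m) → Vec.zipWith f xs zs ≡ Vec.zipWith f ys zs → xs ≡ ys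
zipWith-injectiveˡ f-inj {xs = Vec.[]}  {Vec.[]} Vec.[]   _  = refl
zipWith-injectiveˡ f-inj {xs = x ∷ xs} {y ∷ ys} (z ∷ zs) eq =
  cong₂ _∷_ (f-inj (∷-injectiveˡ eq)) (zipWith-injectiveˡ f-inj zs (∷-injectiveʳ eq))

-- Index 0 is the constant coefficient, so HighestDiff i δ δ′ says that δ − δ′ has degree exactly i.
data HighestDiff {A : Set} : ℕ → ∀ {m} → Vec A m → Vec A m → Set where
  here  : ∀ {m x y} {zs : Vec A m} → x ≢ y → HighestDiff 0 (x ∷ zs) (y ∷ zs)
  there : ∀ {i m x y} {xs ys : Vec A m} → HighestDiff i xs ys → HighestDiff (suc i) (x ∷ xs) (y ∷ ys)

module _ {A : Set} where

  highestDiff⇒≢ : ∀ {i m} {xs ys : Vec A m} → HighestDiff i xs ys → xs ≢ ys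
  highestDiff⇒≢ (here x≢y)  eq = x≢y (∷-injectiveˡ eq)
  highestDiff⇒≢ (there diff) eq = highestDiff⇒≢ diff (∷-injectiveʳ eq)

  highestDiff-init-last : ∀ {i m} {xs ys : Vec A (suc m)} → i < m → HighestDiff i xs ys →
    HighestDiff i (Vec.init xs) (Vec.init ys) × Vec.last xs ≡ Vec.last ys
  highestDiff-init-last {m = suc m} {_ ∷ _ ∷ _} {_ ∷ _ ∷ _} _ (here x≢y) = here x≢y , refl
  highestDiff-init-last {m = suc m} {_ ∷ _ ∷ _} {_ ∷ _ ∷ _} (s≤s i<m) (there diff) =
    let diff′ , last≡ = highestDiff-init-last i<m diff in there diff′ , last≡

  highestDiff-zipWith : ∀ {B C : Set} {f : A → B → C} → (∀ {x x' z} → f x z ≡ f x' z → x ≡ x') →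
    ∀ {i m} {xs ys : Vec A m} (zs : Vec B m) → HighestDiff i xs ys →
    HighestDiff i (Vec.zipWith f xs zs) (Vec.zipWith f ys zs)
  highestDiff-zipWith f-inj (z ∷ zs) (here x≢y)   = here (λ eq → x≢y (f-inj eq))
  highestDiff-zipWith f-inj (z ∷ zs) (there diff) = there (highestDiff-zipWith f-inj zs diff)

x*y≡0⇒[a*x]*[b*y]≡0 : ∀ a b {x y} → x * y ≡ 0 → (a * x) * (b * y) ≡ 0
x*y≡0⇒[a*x]*[b*y]≡0 a b {x} {y} xy≡0 =
  trans (*-interchange a x b y) (trans (cong (a * b *_) xy≡0) (*-zeroʳ (a * b)))

∑ᵣ-select : ∀ {p d} (f : Residue p d → ℕ) β → ∑ᵣ (λ γ → f γ * 𝟙 (γ ≟ᵣ β)) ≡ f β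
∑ᵣ-select f β = begin
  ∑ᵣ (λ γ → f γ * 𝟙 (γ ≟ᵣ β))  ≡⟨ ∑ᵣ-delta β (λ γ γ≢β → trans (cong (f γ *_) (𝟙-no (γ ≟ᵣ β) γ≢β)) (*-zeroʳ (f γ))) ⟩
  f β * 𝟙 (β ≟ᵣ β)             ≡⟨ cong (f β *_) (𝟙-yes (β ≟ᵣ β) refl) ⟩
  f β * 1                      ≡⟨ *-identityʳ (f β) ⟩
  f β                          ∎
  where open ≡-Reasoning

addConst-injective : ∀ {n d} {α α' : Residue (suc n) d} c → addConst α c ≡ addConst α' c → α ≡ α'
addConst-injective {α = Vec.[]}  {Vec.[]}  c _  = refl
addConst-injective {α = a ∷ α} {a' ∷ α'} c eq = cong₂ _∷_ (addF-cancelʳ c (∷-injectiveˡ eq)) (∷-injectiveʳ eq)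

adjM≡𝟙 : ∀ {p d} (u : Monic p d) β α → adjM u β α ≡ 𝟙 (edge? u α β)
adjM≡𝟙 u β α with edge? u α β
... | yes _ = refl
... | no _  = refl

module Graph {n k : ℕ} (u₀ : Fin (suc n)) (us : Vec (Fin (suc n)) k) where

  private
    F = Fin (suc n)
    R = Residue (suc n) (suc k)
    Cs = allFin (suc n)
    Rs = allResidues (suc n) (suc k)

  u : Monic (suc n) (suc k)
  u = u₀ ∷ us

  A : Matrix (suc n) (suc k)
  A = adjM u

  step : F → R → R
  step c α = addConst (mulX u α) c

  subMul : F → F → F → F
  subMul t s v = subF s (mulF t v)

  step-injectiveˡ : ∀ {c c'} γ → step c γ ≡ step c' γ → c ≡ c'
  step-injectiveˡ γ eq = addF-cancelˡ (Vec.head (mulX u γ)) (∷-injectiveˡ eq)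

  -- The constant coefficient of x·γ is −u₀ times the top coefficient of γ, and u₀ ≠ 0 in 𝔽ₚ.
  mulX-injective : Prime (suc n) → toℕ u₀ ≢ 0 → ∀ {γ γ'} → mulX u γ ≡ mulX u γ' → γ ≡ γ'
  mulX-injective p-prime u₀≢0 {γ} {γ'} eq = init-last-injective init≡ last≡
    where
    last≡ : Vec.last γ ≡ Vec.last γ'
    last≡ = mulF-cancelʳ p-prime u₀ u₀≢0 (subF-cancelˡ Fin.zero (∷-injectiveˡ eq))
    init≡ : Vec.init γ ≡ Vec.init γ'
    init≡ = zipWith-injectiveˡ (λ {_} {_} {v} → subF-cancelʳ (mulF (Vec.last γ) v)) us (trans (∷-injectiveʳ eq)
      (cong (λ t → Vec.zipWith (subMul t) (Vec.init γ') us) (sym last≡)))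

  step-injectiveʳ : Prime (suc n) → toℕ u₀ ≢ 0 → ∀ c {γ γ'} → step c γ ≡ step c γ' → γ ≡ γ'
  step-injectiveʳ p-prime u₀≢0 c eq = mulX-injective p-prime u₀≢0 (addConst-injective c eq)

  step-highestDiff-zero : ∀ {c c'} γ → c ≢ c' → HighestDiff 0 (step c γ) (step c' γ)
  step-highestDiff-zero γ c≢c' = here (λ eq → c≢c' (addF-cancelˡ (Vec.head (mulX u γ)) eq))

  -- Below degree d, multiplication by x raises the degree of δ − δ′ without reduction modulo u
  -- (the reducing term depends only on the equal top coefficients); constants only touch degree 0.
  step-highestDiff-suc : ∀ {i δ δ'} → i < k → HighestDiff i δ δ' → ∀ c c' →
    HighestDiff (suc i) (step c δ) (step c' δ')
  step-highestDiff-suc {i} {δ} {δ'} i<k diff c c' =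
    let diff′ , last≡ = highestDiff-init-last i<k diff in
    there (subst (λ t → HighestDiff i (Vec.zipWith (subMul (Vec.last δ)) (Vec.init δ) us)
                                      (Vec.zipWith (subMul t) (Vec.init δ') us))
                 last≡ (highestDiff-zipWith (λ {_} {_} {v} → subF-cancelʳ (mulF (Vec.last δ) v)) us diff′))

  isNonzero : F → ℕ
  isNonzero c = 𝟙 (¬? (toℕ c ℕ.≟ 0))

  ∑-isNonzero : ∑ Cs isNonzero ≡ n
  ∑-isNonzero = begin
    ∑ Cs isNonzero                                 ≡⟨⟩
    sum (map isNonzero (List.tabulate Fin.suc))    ≡⟨ cong sum (map-tabulate Fin.suc isNonzero) ⟩
    sum (List.tabulate {n = n} (λ _ → 1))          ≡⟨ cong sum (map-tabulate {n = n} id (λ _ → 1)) ⟨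
    ∑ (allFin n) (λ _ → 1)                         ≡⟨ ∑-1≡length (allFin n) ⟩
    length (allFin n)                              ≡⟨ length-tabulate {n = n} id ⟩
    n                                              ∎
    where open ≡-Reasoning

  A-as-sum : ∀ δ γ → A δ γ ≡ ∑ Cs (λ c → isNonzero c * 𝟙 (δ ≟ᵣ step c γ))
  A-as-sum δ γ = begin
    A δ γ                                                       ≡⟨ adjM≡𝟙 u δ γ ⟩
    𝟙 (edge? u γ δ)                                             ≡⟨ 𝟙-any? (λ c → ¬? (toℕ c ℕ.≟ 0) ×-dec (δ ≟ᵣ step c γ)) (λ (_ , δ≡) (_ , δ≡') → step-injectiveˡ γ (trans (sym δ≡) δ≡')) ⟩
    ∑ Cs (λ c → 𝟙 (¬? (toℕ c ℕ.≟ 0) ×-dec (δ ≟ᵣ step c γ)))    ≡⟨ ∑-cong Cs (λ c → 𝟙-×-dec (¬? (toℕ c ℕ.≟ 0)) (δ ≟ᵣ step c γ)) ⟩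
    ∑ Cs (λ c → isNonzero c * 𝟙 (δ ≟ᵣ step c γ))                ∎
    where open ≡-Reasoning

  powA-sucʳ : ∀ j β γ → powM A (suc j) β γ ≡ ∑ Cs (λ c → isNonzero c * powM A j β (step c γ))
  powA-sucʳ j β γ = begin
    powM A (suc j) β γ                                                    ≡⟨ powM-sucʳ A j β γ ⟩
    ∑ᵣ (λ δ → W β δ * A δ γ)                                              ≡⟨ ∑-cong Rs (λ δ → cong (W β δ *_) (A-as-sum δ γ)) ⟩
    ∑ᵣ (λ δ → W β δ * ∑ Cs (λ c → isNonzero c * 𝟙 (δ ≟ᵣ step c γ)))      ≡⟨ ∑-cong Rs (λ δ → sym (∑-*ˡ Cs (W β δ) _)) ⟩
    ∑ᵣ (λ δ → ∑ Cs (λ c → W β δ * (isNonzero c * 𝟙 (δ ≟ᵣ step c γ))))    ≡⟨ ∑-swap Rs Cs _ ⟩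
    ∑ Cs (λ c → ∑ᵣ (λ δ → W β δ * (isNonzero c * 𝟙 (δ ≟ᵣ step c γ))))    ≡⟨ ∑-cong Cs (λ c → ∑-cong Rs (λ δ → x*[y*z]≡y*[x*z] (W β δ) (isNonzero c) _)) ⟩
    ∑ Cs (λ c → ∑ᵣ (λ δ → isNonzero c * (W β δ * 𝟙 (δ ≟ᵣ step c γ))))    ≡⟨ ∑-cong Cs (λ c → ∑-*ˡ Rs (isNonzero c) _) ⟩
    ∑ Cs (λ c → isNonzero c * ∑ᵣ (λ δ → W β δ * 𝟙 (δ ≟ᵣ step c γ)))      ≡⟨ ∑-cong Cs (λ c → cong (isNonzero c *_) (∑ᵣ-select (W β) (step c γ))) ⟩
    ∑ Cs (λ c → isNonzero c * W β (step c γ))                             ∎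
    where
    open ≡-Reasoning
    W = powM A j

  ∑-over-nonzero-constants : (h : F → R → ℕ) → (∀ c → ∑ᵣ (h c) ≡ 1) →
    ∑ᵣ (λ γ → ∑ Cs (λ c → isNonzero c * h c γ)) ≡ n
  ∑-over-nonzero-constants h ∑h≡1 = begin
    ∑ᵣ (λ γ → ∑ Cs (λ c → isNonzero c * h c γ))  ≡⟨ ∑-swap Rs Cs _ ⟩
    ∑ Cs (λ c → ∑ᵣ (λ γ → isNonzero c * h c γ))  ≡⟨ ∑-cong Cs (λ c → ∑-*ˡ Rs (isNonzero c) (h c)) ⟩
    ∑ Cs (λ c → isNonzero c * ∑ᵣ (h c))          ≡⟨ ∑-cong Cs (λ c → trans (cong (isNonzero c *_) (∑h≡1 c)) (*-identityʳ (isNonzero c))) ⟩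
    ∑ Cs isNonzero                               ≡⟨ ∑-isNonzero ⟩
    n                                            ∎
    where open ≡-Reasoning

  colSum-A : ∀ α → colSum A α ≡ n
  colSum-A α = trans (∑-cong Rs (λ β → A-as-sum β α))
    (∑-over-nonzero-constants (λ c β → 𝟙 (β ≟ᵣ step c α)) (λ c → ∑ᵣ-indicator (step c α)))

  rowSum-A : Prime (suc n) → toℕ u₀ ≢ 0 → ∀ β → rowSum A β ≡ n
  rowSum-A p-prime u₀≢0 β = trans (∑-cong Rs (A-as-sum β))
    (∑-over-nonzero-constants (λ c γ → 𝟙 (β ≟ᵣ step c γ))
      (λ c → ∑ᵣ-fibre-injective (step c) (step-injectiveʳ p-prime u₀≢0 c) β))

  powA-disjoint : ∀ j {i δ δ'} → i + j < suc k → HighestDiff i δ δ' →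
    ∀ β → powM A j β δ * powM A j β δ' ≡ 0
  powA-disjoint zero    {δ = δ} {δ'} _ diff β = subst₂ (λ x y → x * y ≡ 0) (sym (idM≡𝟙 β δ)) (sym (idM≡𝟙 β δ'))
    (𝟙-*-disjoint (β ≟ᵣ δ) (β ≟ᵣ δ') (λ β≡δ β≡δ' → highestDiff⇒≢ diff (trans (sym β≡δ) β≡δ')))
  powA-disjoint (suc j) {i} {δ} {δ'} i+j<D diff β = begin
    W (suc j) β δ * W (suc j) β δ'
      ≡⟨ cong₂ _*_ (powA-sucʳ j β δ) (powA-sucʳ j β δ') ⟩
    ∑ Cs (λ c → isNonzero c * W j β (step c δ)) * ∑ Cs (λ c' → isNonzero c' * W j β (step c' δ'))
      ≡⟨ ∑-* Cs Cs (λ c → isNonzero c * W j β (step c δ)) (λ c' → isNonzero c' * W j β (step c' δ')) ⟩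
    ∑ Cs (λ c → ∑ Cs (λ c' → (isNonzero c * W j β (step c δ)) * (isNonzero c' * W j β (step c' δ'))))
      ≡⟨ ∑-zero (All.universal (λ c → ∑-zero (All.universal (λ c' → x*y≡0⇒[a*x]*[b*y]≡0 (isNonzero c) (isNonzero c')
           (powA-disjoint j (subst (_< suc k) (+-suc i j) i+j<D) (step-highestDiff-suc i<k diff c c') β)) Cs)) Cs) ⟩
    0 ∎
    where
    open ≡-Reasoning
    W = powM A
    i<k : i < k
    i<k = <-≤-trans (m<m+n i (s≤s z≤n)) (≤-pred i+j<D)

  powA≤1 : ∀ j → j ≤ suc k → ∀ β γ → powM A j β γ ≤ 1
  powA≤1 zero    _     β γ = idM≤1 β γ
  powA≤1 (suc j) j<D β γ = subst (_≤ 1) (sym (powA-sucʳ j β γ)) (∑-≤1 (Unique.allFin⁺ (suc n))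
    (λ c → *-mono-≤ (𝟙≤1 (¬? (toℕ c ℕ.≟ 0))) (powA≤1 j (<⇒≤ j<D) β (step c γ)))
    (λ c c' c≢c' → x*y≡0⇒[a*x]*[b*y]≡0 (isNonzero c) (isNonzero c')
      (powA-disjoint j j<D (step-highestDiff-zero γ c≢c') β)))

adjMᵈ-zeroOne-regular : ∀ {n d} (u : Monic (suc n) d) → Prime (suc n) → XNotDividesMonic u →
  (∀ β α → powM (adjM u) d β α ≤ 1) ×
  (∀ β → rowSum (powM (adjM u) d) β ≡ n ^ d) ×
  (∀ α → colSum (powM (adjM u) d) α ≡ n ^ d)
adjMᵈ-zeroOne-regular {d = zero}  Vec.[]    _       _     = idM≤1 , idM-rowSum , idM-colSum
adjMᵈ-zeroOne-regular {d = suc k} (u₀ ∷ us) p-prime u₀≢0 =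
  powA≤1 (suc k) ≤-refl , powM-rowSum (rowSum-A p-prime u₀≢0) (suc k) , powM-colSum colSum-A (suc k)
  where open Graph u₀ us

adjM²ᵈ-bounds : ∀ {n d} (u : Monic (suc n) d) → Prime (suc n) → XNotDividesMonic u →
  ∀ β α → (n ^ d + n ^ d ≤ powM (adjM u) (2 * d) β α + suc n ^ d) × (powM (adjM u) (2 * d) β α ≤ n ^ d)
adjM²ᵈ-bounds {n} {d} u p-prime x∤u β α =
  let Aᵈ≤1 , rows , cols = adjMᵈ-zeroOne-regular u p-prime x∤u in
  subst (λ w → (n ^ d + n ^ d ≤ w + suc n ^ d) × (w ≤ n ^ d)) (sym A²ᵈ≡Aᵈ·Aᵈ)
    (square-bounds Aᵈ≤1 rows cols β α)
  where
  A = adjM u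
  A²ᵈ≡Aᵈ·Aᵈ : powM A (2 * d) β α ≡ mulM (powM A d) (powM A d) β α
  A²ᵈ≡Aᵈ·Aᵈ = trans (cong (λ i → powM A (d + i) β α) (+-identityʳ d)) (powM-+ A d d β α)

-- From entry bounds to the normalised deviation

m+m≤n+o⇒2m-o≤n : ∀ {m n o} → m + m ≤ n + o → + 2 ℤ.* + m ℤ.- + o ℤ.≤ + n
m+m≤n+o⇒2m-o≤n {m} {n} {o} le = begin
  + 2 ℤ.* + m ℤ.- + o  ≡⟨ cong (ℤ._- + o) (ℤ.pos-* 2 m) ⟨
  + (2 * m) ℤ.- + o    ≡⟨ ℤ.[+m]-[+n]≡m⊖n (2 * m) o ⟩
  2 * m ⊖ o            ≤⟨ ℤ.⊖-monoˡ-≤ o (subst (_≤ n + o) (cong (_+_ m) (sym (+-identityʳ m))) le) ⟩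
  (n + o) ⊖ o          ≡⟨ ℤ.≤-⊖ (m≤n+m o n) ⟩
  + (n + o ∸ o)        ≡⟨ cong +_ (m+n∸n≡m n o) ⟩
  + n                  ∎
  where open ℤ.≤-Reasoning

≤-from-gap : ∀ {x y k : ℤ} → 0ℤ ℤ.≤ k → x ≡ y ℤ.+ k → y ℤ.≤ x
≤-from-gap {x} {y} {k} 0≤k eq = subst₂ ℤ._≤_ (ℤ.+-identityʳ y) (sym eq) (ℤ.+-monoʳ-≤ y 0≤k)

0≤i*j : ∀ {i j} → 0ℤ ℤ.≤ i → 0ℤ ℤ.≤ j → 0ℤ ℤ.≤ i ℤ.* j
0≤i*j {+ m} {+ n} _ _ = subst (0ℤ ℤ.≤_) (ℤ.pos-* m n) (+≤+ z≤n)

-- Cross-multiplied forms of P·(W/a² − 1/P) ≤ P/a − 1 and P·(1/P − W/a²) ≤ P/a − 1, in the exact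
-- shape produced by unfolding ℚᵘ's operations; in both the gap is a product of non-negative factors.
excess-cross : ∀ a P W K → a ≡ W ℤ.+ K → 0ℤ ℤ.≤ P → 0ℤ ℤ.≤ W → 0ℤ ℤ.≤ K →
  (P ℤ.* (W ℤ.* P ℤ.+ ℤ.- + 1 ℤ.* (a ℤ.* a))) ℤ.* (a ℤ.* + 1)
    ℤ.≤ (P ℤ.* + 1 ℤ.+ ℤ.- + 1 ℤ.* a) ℤ.* (+ 1 ℤ.* ((a ℤ.* a) ℤ.* P))
excess-cross .(W ℤ.+ K) P W K refl 0≤P 0≤W 0≤K =
  ≤-from-gap (0≤i*j (0≤i*j (0≤i*j 0≤P 0≤P) (ℤ.+-mono-≤ 0≤W 0≤K)) 0≤K) (gap P W K)
  where
  gap : ∀ P W K → let a = W ℤ.+ K in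
    (P ℤ.* + 1 ℤ.+ ℤ.- + 1 ℤ.* a) ℤ.* (+ 1 ℤ.* ((a ℤ.* a) ℤ.* P))
      ≡ (P ℤ.* (W ℤ.* P ℤ.+ ℤ.- + 1 ℤ.* (a ℤ.* a))) ℤ.* (a ℤ.* + 1) ℤ.+ P ℤ.* P ℤ.* a ℤ.* K
  gap = solve-∀

deficit-cross : ∀ a P W E → P ≡ a ℤ.+ E → 0ℤ ℤ.≤ a → 0ℤ ℤ.≤ W → 0ℤ ℤ.≤ E → 0ℤ ℤ.≤ W ℤ.+ E ℤ.- a →
  (P ℤ.* ℤ.- (W ℤ.* P ℤ.+ ℤ.- + 1 ℤ.* (a ℤ.* a))) ℤ.* (a ℤ.* + 1)
    ℤ.≤ (P ℤ.* + 1 ℤ.+ ℤ.- + 1 ℤ.* a) ℤ.* (+ 1 ℤ.* ((a ℤ.* a) ℤ.* P))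
deficit-cross a .(a ℤ.+ E) W E refl 0≤a 0≤W 0≤E 0≤W+E-a =
  ≤-from-gap (0≤i*j (0≤i*j (ℤ.+-mono-≤ 0≤a 0≤E) 0≤a) (ℤ.+-mono-≤ (0≤i*j 0≤a 0≤W+E-a) (0≤i*j 0≤W 0≤E))) (gap a W E)
  where
  gap : ∀ a W E → let P = a ℤ.+ E in
    (P ℤ.* + 1 ℤ.+ ℤ.- + 1 ℤ.* a) ℤ.* (+ 1 ℤ.* ((a ℤ.* a) ℤ.* P))
      ≡ (P ℤ.* ℤ.- (W ℤ.* P ℤ.+ ℤ.- + 1 ℤ.* (a ℤ.* a))) ℤ.* (a ℤ.* + 1)
        ℤ.+ P ℤ.* a ℤ.* (a ℤ.* (W ℤ.+ E ℤ.- a) ℤ.+ W ℤ.* E)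
  gap = solve-∀

toℚᵘ-/′ : ∀ i m → toℚᵘ (i /′ suc m) ℚᵘ.≃ mkℚᵘ i m
toℚᵘ-/′ i m = toℚᵘ-fromℚᵘ (mkℚᵘ i m)

toℚᵘ-/′-/′ : ∀ i m j k → toℚᵘ ((i /′ suc m) ℚ.- (j /′ suc k)) ℚᵘ.≃ mkℚᵘ i m ℚᵘ.- mkℚᵘ j k
toℚᵘ-/′-/′ i m j k = ℚᵘ.≃-trans (toℚᵘ-homo-+ (i /′ suc m) (ℚ.- (j /′ suc k)))
  (ℚᵘ.+-cong (toℚᵘ-/′ i m) (ℚᵘ.≃-trans (toℚᵘ-homo‿- (j /′ suc k)) (ℚᵘ.-‿cong (toℚᵘ-/′ j k))))

≤-via-ℚᵘ : ∀ {p q : ℚ} {p′ q′ : ℚᵘ} → toℚᵘ p ℚᵘ.≃ p′ → toℚᵘ q ℚᵘ.≃ q′ → p′ ℚᵘ.≤ q′ → p ℚ.≤ q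
≤-via-ℚᵘ p≃p′ q≃q′ p′≤q′ = toℚᵘ-cancel-≤ (ℚᵘ.≤-respˡ-≃ (ℚᵘ.≃-sym p≃p′) (ℚᵘ.≤-respʳ-≃ (ℚᵘ.≃-sym q≃q′) p′≤q′))

deviation-bound : ∀ {a P W} → 1 ≤ a → a ≤ P → W ≤ a → a + a ≤ W + P →
  ((+ P) /′ 1) ℚ.* ℚ.∣ ((+ W) /′ (a * a)) ℚ.- ((+ 1) /′ P) ∣ ℚ.≤ ((+ P) /′ a) ℚ.- ℚ.1ℚ
deviation-bound {suc a′} {suc P′} {W} _ a≤P W≤a a+a≤W+P =
  [ (λ ∣X∣≡X  → subst (λ y → P/1 ℚ.* y ℚ.≤ R) (sym ∣X∣≡X) excess)
  , (λ ∣X∣≡-X → subst (λ y → P/1 ℚ.* y ℚ.≤ R) (sym ∣X∣≡-X) deficit)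
  ]′ (∣p∣≡p∨∣p∣≡-p X)
  where
  a = suc a′
  P = suc P′
  P/1 = (+ P) /′ 1
  X = ((+ W) /′ (a * a)) ℚ.- ((+ 1) /′ P)
  R = ((+ P) /′ a) ℚ.- ℚ.1ℚ
  toℚᵘ-X : toℚᵘ X ℚᵘ.≃ mkℚᵘ (+ W) (ℕ.pred (a * a)) ℚᵘ.- mkℚᵘ (+ 1) P′
  toℚᵘ-X = toℚᵘ-/′-/′ (+ W) (ℕ.pred (a * a)) (+ 1) P′
  toℚᵘ-R : toℚᵘ R ℚᵘ.≃ mkℚᵘ (+ P) a′ ℚᵘ.- mkℚᵘ (+ 1) 0
  toℚᵘ-R = toℚᵘ-/′-/′ (+ P) a′ (+ 1) 0
  nonneg : ∀ {m} → 0ℤ ℤ.≤ + m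
  nonneg = +≤+ z≤n
  excess : P/1 ℚ.* X ℚ.≤ R
  excess = ≤-via-ℚᵘ (ℚᵘ.≃-trans (toℚᵘ-homo-* P/1 X) (ℚᵘ.*-cong (toℚᵘ-/′ (+ P) 0) toℚᵘ-X)) toℚᵘ-R
    (*≤* (excess-cross (+ a) (+ P) (+ W) (+ (a ∸ W))
      (trans (cong +_ (sym (m+[n∸m]≡n W≤a))) (ℤ.pos-+ W (a ∸ W))) nonneg nonneg nonneg))
  a≤W+E : a ≤ W + (P ∸ a)
  a≤W+E = +-cancelˡ-≤ a a (W + (P ∸ a)) (subst (a + a ≤_) (begin
    W + P                ≡⟨ cong (_+_ W) (m+[n∸m]≡n a≤P) ⟨
    W + (a + (P ∸ a))    ≡⟨ x+[y+z]≡y+[x+z] W a (P ∸ a) ⟩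
    a + (W + (P ∸ a))    ∎) a+a≤W+P)
    where open ≡-Reasoning
  deficit : P/1 ℚ.* (ℚ.- X) ℚ.≤ R
  deficit = ≤-via-ℚᵘ (ℚᵘ.≃-trans (toℚᵘ-homo-* P/1 (ℚ.- X))
      (ℚᵘ.*-cong (toℚᵘ-/′ (+ P) 0) (ℚᵘ.≃-trans (toℚᵘ-homo‿- X) (ℚᵘ.-‿cong toℚᵘ-X)))) toℚᵘ-R
    (*≤* (deficit-cross (+ a) (+ P) (+ W) (+ (P ∸ a))
      (trans (cong +_ (sym (m+[n∸m]≡n a≤P))) (ℤ.pos-+ a (P ∸ a))) nonneg nonneg nonneg
      (ℤ.i≤j⇒0≤j-i (subst (+ a ℤ.≤_) (ℤ.pos-+ W (P ∸ a)) (+≤+ a≤W+E)))))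

lemma4p8 : (p d : ℕ) → Prime p → (u : Monic p d) → XNotDividesMonic u →
    ((β α : Residue p d) →
        ((+ 2) ℤ.* (+ ((p ∸ 1) ^ d)) ℤ.- (+ (p ^ d)) ℤ.≤ + (powM (adjM u) (2 ℕ.* d) β α))
        × (powM (adjM u) (2 ℕ.* d) β α ℕ.≤ (p ∸ 1) ^ d))
    × ((β α : Residue p d) →
        ((+ (p ^ d)) /′ 1) ℚ.* ℚ.∣ ((+ (powM (adjM u) (2 ℕ.* d) β α)) /′ ((p ∸ 1) ^ (2 ℕ.* d))) ℚ.- ((+ 1) /′ (p ^ d)) ∣
          ℚ.≤ ((+ (p ^ d)) /′ ((p ∸ 1) ^ d)) ℚ.- ℚ.1ℚ)
lemma4p8 zero           d p-prime = contradiction p-prime ¬prime[0]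
lemma4p8 (suc zero)     d p-prime = contradiction p-prime ¬prime[1]
lemma4p8 (suc (suc n′)) d p-prime u x∤u =
  (λ β α → m+m≤n+o⇒2m-o≤n {a} (lower β α) , upper β α) ,
  (λ β α → subst (λ m → (+ P) /′ 1 ℚ.* ℚ.∣ (+ W β α) /′ m ℚ.- (+ 1) /′ P ∣ ℚ.≤ (+ P) /′ a ℚ.- ℚ.1ℚ)
                 (sym n²ᵈ≡a*a) (deviation-bound (m^n>0 n d) (^-monoˡ-≤ d (n≤1+n n)) (upper β α) (lower β α)))
  where
  n = suc n′
  a = n ^ d
  P = suc n ^ d
  W = powM (adjM u) (2 * d)
  lower : ∀ β α → a + a ≤ W β α + P
  lower β α = proj₁ (adjM²ᵈ-bounds u p-prime x∤u β α)
  upper : ∀ β α → W β α ≤ a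
  upper β α = proj₂ (adjM²ᵈ-bounds u p-prime x∤u β α)
  n²ᵈ≡a*a : n ^ (2 * d) ≡ a * a
  n²ᵈ≡a*a = trans (cong (λ i → n ^ (d + i)) (+-identityʳ d)) (^-distribˡ-+-* n d d)
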